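{- Let $\mathcal D$ be a database schema, $\mathcal U$ a domain, $\mathcal N=\{1,\dots,n\}$, and $Con\subseteq\mathcal U$ a set of constants. (1) If an aggregation procedure $F$ is unanimous and grounded, then $F$ is collectively rational with respect to $\mathit{lit}$. (2) If $Con=\mathcal U$, then every aggregation procedure that is collectively rational with respect to $\mathit{lit}$ is unanimous and grounded.
   Context: A database schema $\mathcal D$ is a finite set of relation symbols, each with an arity. Fix a countable domain $\mathcal U$. A $\mathcal D$-instance is a map $D$ assigning to each $P\in\mathcal D$ of arity $q$ a finite relation $D(P)\subseteq\mathcal U^q$; $\mathcal D(\mathcal U)$ is the set of all instances. A profile is $\vec D=(D_1,\dots,D_n)\in\mathcal D(\mathcal U)^n$ and an aggregation procedure is a function $F:\mathcal D(\mathcal U)^n\to\mathcal D(\mathcal U)$. The first-order language over $\mathcal D$ is extended with a set $Con\subseteq\mathcal U$ of constant symbols, each $c\in Con$ interpreted as the element $c$ itself in every instance. $\mathit{lit}^+$ is the set of positive ground literals $P(c_1,\dots,c_q)$ with $P\in\mathcal D$ of arity $q$ and $c_i\in Con$; $\mathit{lit}^-$ is the set of negative literals $\neg P(c_1,\dots,c_q)$; $\mathit{lit}=\mathit{lit}^+\cup\mathit{lit}^-$. An instance $D$ satisfies $P(c_1,\dots,c_q)$ iff $(c_1,\dots,c_q)\in D(P)$. $F$ is collectively rational with respect to a set of sentences if it lifts each of them: for each sentence $\phi$ in the set and each profile $\vec D$, if $D_i\models\phi$ for all $i\in\mathcal N$ then $F(\vec D)\models\phi$. $F$ is unanimous if $F(\vec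 D)(P)\supseteq\bigcap_{i\in\mathcal N}D_i(P)$ for all profiles and all $P$; grounded if $F(\vec D)(P)\subseteq\bigcup_{i\in\mathcal N}D_i(P)$ for all profiles and all $P$. -}

module Defs where

open import Data.Nat using (ℕ)
open import Data.Fin using (Fin)
open import Data.Vec using (Vec)
open import Data.Vec.Relation.Unary.All using (All)
open import Data.List using (List)
open import Data.List.Membership.Propositional using (_∈_)
open import Data.Product using (_×_)
open import Relation.Nullary using (¬_)

record Schema : Set where
  field
    size  : ℕ
    arity : Fin size → ℕ
open Schema public

Sym : Schema → Set
Sym S = Fin (size S)

-- A D-instance: each symbol P of arity q gets a finite relation ⊆ U^q,
-- represented as a finite list of q-tuples (membership is what matters).
Instance : Schema → Set → Set
Instance S U = (P : Sym S) → List (Vec U (arity S P))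

Profile : Schema → Set → ℕ → Set
Profile S U n = Fin n → Instance S U

Aggregator : Schema → Set → ℕ → Set
Aggregator S U n = Profile S U n → Instance S U

-- Ground literals over the constants Con ⊆ U (constants denote themselves).
data Lit (S : Schema) {U : Set} (Con : U → Set) : Set where
  pos : (P : Sym S) (cs : Vec U (arity S P)) → All Con cs → Lit S Con
  neg : (P : Sym S) (cs : Vec U (arity S P)) → All Con cs → Lit S Con

_⊨_ : {S : Schema} {U : Set} {Con : U → Set} → Instance S U → Lit S Con → Set
D ⊨ pos P cs _ = cs ∈ D P
D ⊨ neg P cs _ = ¬ (cs ∈ D P)

Lifts : {S : Schema} {U : Set} {n : ℕ} {Con : U → Set} →
        Aggregator S U n → Lit S Con → Set
Lifts {S} {U} {n} F φ =
  (Ds : Profile S U n) → ((i : Fin n) → Ds i ⊨ φ) → F Ds ⊨ φ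

CollRatLit : {S : Schema} {U : Set} {n : ℕ} (Con : U → Set) → Aggregator S U n → Set
CollRatLit {S} Con F = (φ : Lit S Con) → Lifts F φ

Unanimous : {S : Schema} {U : Set} {n : ℕ} → Aggregator S U n → Set
Unanimous {S} {U} {n} F =
  (Ds : Profile S U n) (P : Sym S) (t : Vec U (arity S P)) →
  ((i : Fin n) → t ∈ Ds i P) → t ∈ F Ds P

Grounded : {S : Schema} {U : Set} {n : ℕ} → Aggregator S U n → Set
Grounded {S} {U} {n} F =
  (Ds : Profile S U n) (P : Sym S) (t : Vec U (arity S P)) →
  t ∈ F Ds P → Data.Product.∃ (λ (i : Fin n) → t ∈ Ds i P)

module Submission where

-- A positive literal P(c⃗) holds in every Dᵢ exactly when c⃗ lies in the
-- intersection ⋂ᵢ Dᵢ(P), and a negative literal ¬P(c⃗) holds in every Dᵢ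
-- exactly when c⃗ lies outside the union ⋃ᵢ Dᵢ(P).  Hence unanimity is the
-- same as lifting all positive literals and groundedness the same as lifting
-- all negative literals, provided every tuple of the domain is named by
-- constants (Con = U), which is what part (2) assumes.
--
-- The only non-propositional step is groundedness: from "c⃗ is not outside
-- the union" we must produce an individual i with c⃗ ∈ Dᵢ(P).  This is done
-- constructively by deciding membership in the finitely many finite
-- relations Dᵢ(P), which is possible because a countable domain, being
-- injected into ℕ, has decidable equality.

open import Defs
open import Data.Nat using (ℕ)
import Data.Nat.Properties as ℕ
open import Data.Fin using (Fin)
open import Data.Fin.Properties using (any?)
open import Data.Vec using (Vec)
import Data.Vec.Properties as Vec
open import Data.Vec.Relation.Unary.All using (All; universal)
import Data.List.Membership.DecPropositional as DecMembership
open import Data.Product using (_×_; _,_; ∃)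
open import Function.Bundles using (_↣_; Injection)
open import Relation.Nullary using (yes; no)
open import Relation.Nullary.Decidable using (map′)
open import Relation.Binary.PropositionalEquality using (cong)
open import Relation.Binary.Definitions using (DecidableEquality)
open import Data.Empty using (⊥-elim)

module _ {S : Schema} {U : Set} {n : ℕ} {Con : U → Set} (F : Aggregator S U n) where

  unanimous⇒lifts-pos : Unanimous F →
    (P : Sym S) (cs : Vec U (arity S P)) (named : All Con cs) → Lifts F (pos P cs named)
  unanimous⇒lifts-pos unanimous P cs _ Ds inAll = unanimous Ds P cs inAll

  lifts-pos⇒unanimous : ((P : Sym S) (cs : Vec U (arity S P)) → All Con cs) →
    ((P : Sym S) (cs : Vec U (arity S P)) (named : All Con cs) → Lifts F (pos P cs named)) →
    Unanimous F
  lifts-pos⇒unanimous naming lifts Ds P t inAll = lifts P t (naming P t) Ds inAll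

  grounded⇒lifts-neg : Grounded F →
    (P : Sym S) (cs : Vec U (arity S P)) (named : All Con cs) → Lifts F (neg P cs named)
  grounded⇒lifts-neg grounded P cs _ Ds notInAny inOutput =
    let (i , inDᵢ) = grounded Ds P cs inOutput in notInAny i inDᵢ

  lifts-neg⇒grounded : DecidableEquality U →
    ((P : Sym S) (cs : Vec U (arity S P)) → All Con cs) →
    ((P : Sym S) (cs : Vec U (arity S P)) (named : All Con cs) → Lifts F (neg P cs named)) →
    Grounded F
  lifts-neg⇒grounded _≟_ naming lifts Ds P t inOutput
    with any? (λ i → DecMembership._∈?_ (Vec.≡-dec _≟_) t (Ds i P))
  ... | yes inSome = inSome
  ... | no  inNone = ⊥-elim (lifts P t (naming P t) Ds (λ i inDᵢ → inNone (i , inDᵢ)) inOutput)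

injection⇒decidableEquality : {U : Set} → U ↣ ℕ → DecidableEquality U
injection⇒decidableEquality ι u v =
  map′ (Injection.injective ι) (cong (Injection.to ι)) (Injection.to ι u ℕ.≟ Injection.to ι v)

theorem1 : (S : Schema) (U : Set) (countable : U ↣ ℕ) (n : ℕ) (Con : U → Set) →
           ((F : Aggregator S U n) → Unanimous F → Grounded F → CollRatLit Con F)
           × (((u : U) → Con u) →
              (F : Aggregator S U n) → CollRatLit Con F → Unanimous F × Grounded F)
theorem1 S U countable n Con = sufficient , necessary
  where
  sufficient : (F : Aggregator S U n) → Unanimous F → Grounded F → CollRatLit Con F
  sufficient F unanimous grounded (pos P cs named) = unanimous⇒lifts-pos F unanimous P cs named
  sufficient F unanimous grounded (neg P cs named) = grounded⇒lifts-neg F grounded P cs named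

  necessary : ((u : U) → Con u) →
              (F : Aggregator S U n) → CollRatLit Con F → Unanimous F × Grounded F
  necessary everyConstant F rational =
      lifts-pos⇒unanimous F naming (λ P cs named → rational (pos P cs named))
    , lifts-neg⇒grounded F (injection⇒decidableEquality countable) naming
        (λ P cs named → rational (neg P cs named))
    where
    naming : (P : Sym S) (cs : Vec U (arity S P)) → All Con cs
    naming _ cs = universal everyConstant cs
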